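{- $H_{2^n}$ is uncollapsed for all $n \geq 3$; $H_{3^n}$ is uncollapsed for all $n \geq 2$; $H_{5^n}$ is uncollapsed for all $n \geq 1$.
   Context: For a positive integer $m$, $H_m = \langle a,b,c \mid a^2,b^2,c^2,(ab)^3,(ac)^2,(bc)^m,(bac)^m\rangle$. For positive integers $m,k$ we write $H_m = H_k$ if the two presentations define the same quotient of the free group on $a,b,c$ (the normal closures of the relator sets in the free group coincide). $H_m$ is called uncollapsed if $H_m \neq H_k$ for all integers $1 \leq k < m$. -}

module Defs where

open import Data.Nat using (ℕ; zero; suc; _≤_; _<_)
open import Data.Fin using (Fin; zero; suc)
open import Data.Bool using (Bool; true; false; not)
open import Data.Product using (_×_; _,_)
open import Data.List using (List; []; _∷_; _++_; map; reverse)
open import Data.List.Membership.Propositional using (_∈_)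
open import Relation.Nullary using (¬_)
open import Function.Bundles using (_⇔_)

-- Words in the free group on three generators a, b, c.
-- A letter is a generator index together with a flag: false = x, true = x⁻¹.
Letter : Set
Letter = Fin 3 × Bool

Word : Set
Word = List Letter

invL : Letter → Letter
invL (i , e) = (i , not e)

inv : Word → Word
inv w = reverse (map invL w)

_^w_ : Word → ℕ → Word
w ^w zero = []
w ^w suc n = w ++ (w ^w n)

-- Free equivalence: the equivalence relation generated by cancelling x x⁻¹.
-- Its classes are the elements of the free group F(a,b,c).
data FreeEq : Word → Word → Set where
  fe-refl  : ∀ {w} → FreeEq w w
  fe-sym   : ∀ {u v} → FreeEq u v → FreeEq v u
  fe-trans : ∀ {u v w} → FreeEq u v → FreeEq v w → FreeEq u w
  fe-red   : ∀ u x v → FreeEq (u ++ x ∷ invL x ∷ v) (u ++ v)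

-- Normal closure of a set R of relators in the free group: the set of
-- (words representing) products of conjugates u r^{±1} u⁻¹ of relators,
-- closed under free equivalence.
data NC (R : List Word) : Word → Set where
  nc-one  : NC R []
  nc-conj : ∀ {r w} u → r ∈ R → NC R w → NC R (u ++ r ++ inv u ++ w)
  nc-conjInv : ∀ {r w} u → r ∈ R → NC R w → NC R (u ++ inv r ++ inv u ++ w)
  nc-free : ∀ {w w'} → FreeEq w w' → NC R w → NC R w'

a b c : Word
a = (zero , false) ∷ []
b = (suc zero , false) ∷ []
c = (suc (suc zero) , false) ∷ []

relH : ℕ → List Word
relH m = (a ^w 2) ∷ (b ^w 2) ∷ (c ^w 2) ∷ ((a ++ b) ^w 3) ∷ ((a ++ c) ^w 2)
       ∷ ((b ++ c) ^w m) ∷ ((b ++ a ++ c) ^w m) ∷ []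

-- H_m = H_k : the normal closures of the relator sets coincide
SameH : ℕ → ℕ → Set
SameH m k = ∀ w → NC (relH m) w ⇔ NC (relH k) w

Uncollapsed : ℕ → Set
Uncollapsed m = ∀ k → 1 ≤ k → k < m → ¬ SameH m k

module Submission where

-- To show that H_m is uncollapsed we exhibit, for every k with
-- 1 ≤ k < m, a word (namely (bc)^k) which lies in the normal closure of the
-- relators of H_k but not in that of H_m.  Membership in the normal closure
-- of H_m is refuted with a quotient: a monomial representation of the free
-- group, i.e. an action on ℤ^n in which every generator permutes the
-- coordinates and translates them by integers, reduced modulo M.
--
-- A "witness" for an exponent o is a single monomial representation under
-- which (bc)^o and (bac)^o are pure translations, bc has an orbit of length
-- exactly o and (bc)^o translates some coordinate by ±1; from it we derive
-- that H_{M·o} is uncollapsed for every M.  The theorem follows from three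
-- explicit witnesses (of degrees 42, 20 and 12, for o = 8, 9 and 5), whose
-- defining properties are checked by evaluation.

open import Defs
open import Data.Nat as ℕ using (ℕ; zero; suc; _≤_; _∸_; _^_; NonZero)
import Data.Nat.Properties as ℕP
open import Data.Nat.DivMod using (_divMod_; result)
import Data.Nat.Divisibility as ℕD
open import Data.Integer as ℤ using (ℤ; +_; 0ℤ; 1ℤ; -1ℤ; ∣_∣; _+_; _*_)
import Data.Integer.Properties as ℤP
open import Data.Integer.Divisibility.Signed
  using (_∣_; ∣ᵤ⇒∣; ∣⇒∣ᵤ; ∣m∣n⇒∣m+n; ∣m+n∣m⇒∣n; ∣m⇒∣m*n; ∣-refl)
open import Algebra.Properties.CommutativeSemigroup ℤP.+-commutativeSemigroup
  using (x∙yz≈y∙xz)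
open import Data.Fin using (Fin; toℕ; #_)
import Data.Fin.Properties as FinP
open import Data.Vec using (Vec; lookup; replicate; _[_]≔_; _∷_; [])
open import Data.Product using (_×_; _,_; proj₁; proj₂)
open import Data.Sum using (inj₁; inj₂)
open import Data.List using (List; []; _∷_; _++_; map)
import Data.List.Properties as ListP
open import Data.List.Relation.Unary.All as All using (All)
open import Data.List.Relation.Unary.Any using (here; there)
open import Data.List.Membership.Propositional using (_∈_)
open import Data.List.Membership.Propositional.Properties using (∈-++⁻)
open import Relation.Nullary using (Dec)
open import Relation.Nullary.Decidable using (True; toWitness; map′; _×-dec_; _→-dec_)
open import Relation.Binary.PropositionalEquality
open import Function.Base using (_∘_)
open import Function.Bundles using (Equivalence)

^w-+ : ∀ (w : Word) m n → w ^w (m ℕ.+ n) ≡ (w ^w m) ++ (w ^w n)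
^w-+ w zero    n = refl
^w-+ w (suc m) n = trans (cong (w ++_) (^w-+ w m n)) (sym (ListP.++-assoc w (w ^w m) (w ^w n)))

^w-* : ∀ (w : Word) j o → w ^w (j ℕ.* o) ≡ (w ^w o) ^w j
^w-* w zero    o = refl
^w-* w (suc j) o = trans (^w-+ w o (j ℕ.* o)) (cong ((w ^w o) ++_) (^w-* w j o))

inv-∷ : ∀ x u → inv (x ∷ u) ≡ inv u ++ invL x ∷ []
inv-∷ x u = ListP.unfold-reverse (invL x) (map invL u)

conj-assoc : ∀ (u r u' w : Word) → (u ++ r ++ u') ++ w ≡ u ++ r ++ u' ++ w
conj-assoc u r u' w = trans (ListP.++-assoc u (r ++ u') w) (cong (u ++_) (ListP.++-assoc r u' w))

-- Generator x acts on ℤ^n by moving coordinate i to σ x i and adding τ x i.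
-- For the letters x and x⁻¹ to act by the same map, the action of each
-- generator must be an involution, which is what the two laws say.
Involutive : ∀ {n} → (Fin 3 → Fin n → Fin n) → Set
Involutive σ = ∀ x i → σ x (σ x i) ≡ i

Antisymmetric : ∀ {n} → (Fin 3 → Fin n → Fin n) → (Fin 3 → Fin n → ℤ) → Set
Antisymmetric σ τ = ∀ x i → τ x i + τ x (σ x i) ≡ 0ℤ

involutive? : ∀ {n} (σ : Fin 3 → Fin n → Fin n) → Dec (Involutive σ)
involutive? σ = FinP.all? λ x → FinP.all? λ i → σ x (σ x i) FinP.≟ i

antisymmetric? : ∀ {n} σ (τ : Fin 3 → Fin n → ℤ) → Dec (Antisymmetric σ τ)
antisymmetric? σ τ = FinP.all? λ x → FinP.all? λ i → τ x i + τ x (σ x i) ℤ.≟ 0ℤ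

record MonomialRep : Set where
  field
    degree        : ℕ
    σ             : Fin 3 → Fin degree → Fin degree
    τ             : Fin 3 → Fin degree → ℤ
    involutive    : Involutive σ
    antisymmetric : Antisymmetric σ τ

table : ∀ {A : Set} {n} → Vec (Vec A n) 3 → Fin 3 → Fin n → A
table rows x = lookup (lookup rows x)

fromTables : (n : ℕ) (σs : Vec (Vec (Fin n) n) 3) (τs : Vec (Vec ℤ n) 3) →
             {True (involutive? (table σs))} → {True (antisymmetric? (table σs) (table τs))} →
             MonomialRep
fromTables n σs τs {inv-ok} {anti-ok} = record
  { degree        = n
  ; σ             = table σs
  ; τ             = table τs
  ; involutive    = toWitness inv-ok
  ; antisymmetric = toWitness anti-ok
  }

module Action (ρ : MonomialRep) where
  open MonomialRep ρ

  perm : Word → Fin degree → Fin degree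
  perm []            i = i
  perm ((x , _) ∷ w) i = perm w (σ x i)

  shift : Word → Fin degree → ℤ
  shift []            i = 0ℤ
  shift ((x , _) ∷ w) i = τ x i + shift w (σ x i)

  perm-++ : ∀ u v i → perm (u ++ v) i ≡ perm v (perm u i)
  perm-++ []            v i = refl
  perm-++ ((x , _) ∷ u) v i = perm-++ u v (σ x i)

  shift-++ : ∀ u v i → shift (u ++ v) i ≡ shift u i + shift v (perm u i)
  shift-++ []            v i = sym (ℤP.+-identityˡ _)
  shift-++ ((x , _) ∷ u) v i =
    trans (cong (_+_ (τ x i)) (shift-++ u v (σ x i))) (sym (ℤP.+-assoc (τ x i) _ _))

  infix 4 _≈_
  record _≈_ (w w' : Word) : Set where
    constructor agree
    field
      perm≡  : ∀ i → perm w i ≡ perm w' i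
      shift≡ : ∀ i → shift w i ≡ shift w' i
  open _≈_

  ≈-refl : ∀ {w} → w ≈ w
  ≈-refl = agree (λ i → refl) (λ i → refl)

  ≈-sym : ∀ {w w'} → w ≈ w' → w' ≈ w
  ≈-sym e = agree (λ i → sym (perm≡ e i)) (λ i → sym (shift≡ e i))

  ≈-trans : ∀ {u v w} → u ≈ v → v ≈ w → u ≈ w
  ≈-trans e f = agree (λ i → trans (perm≡ e i) (perm≡ f i)) (λ i → trans (shift≡ e i) (shift≡ f i))

  ≈-++ : ∀ {u u' v v'} → u ≈ u' → v ≈ v' → u ++ v ≈ u' ++ v'
  ≈-++ {u} {u'} {v} {v'} eu ev = agree
    (λ i → trans (perm-++ u v i) (trans (perm≡ ev (perm u i))
             (trans (cong (perm v') (perm≡ eu i)) (sym (perm-++ u' v' i)))))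
    (λ i → trans (shift-++ u v i) (trans (cong₂ _+_ (shift≡ eu i)
             (trans (shift≡ ev (perm u i)) (cong (shift v') (perm≡ eu i))))
             (sym (shift-++ u' v' i))))

  cancel-pair : ∀ x → x ∷ invL x ∷ [] ≈ []
  cancel-pair (x , _) = agree (involutive x)
    (λ i → trans (cong (_+_ (τ x i)) (ℤP.+-identityʳ _)) (antisymmetric x i))

  free-invariant : ∀ {w w'} → FreeEq w w' → w ≈ w'
  free-invariant fe-refl         = ≈-refl
  free-invariant (fe-sym e)      = ≈-sym (free-invariant e)
  free-invariant (fe-trans e f)  = ≈-trans (free-invariant e) (free-invariant f)
  free-invariant (fe-red u x v)  = ≈-++ (≈-refl {u}) (≈-++ (cancel-pair x) (≈-refl {v}))

  Trivial : Word → Set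
  Trivial w = w ≈ []

  trivial? : ∀ w → Dec (Trivial w)
  trivial? w = map′ (λ t → agree (proj₁ ∘ t) (proj₂ ∘ t)) (λ t i → perm≡ t i , shift≡ t i)
    (FinP.all? λ i → (perm w i FinP.≟ i) ×-dec (shift w i ℤ.≟ 0ℤ))

  inv-cancel : ∀ u → Trivial (u ++ inv u)
  inv-cancel []      = ≈-refl
  inv-cancel (x ∷ u) = subst Trivial (sym regroup)
      (≈-trans (≈-++ (≈-refl {x ∷ []}) (≈-++ (inv-cancel u) (≈-refl {invL x ∷ []})))
               (cancel-pair x))
    where
    regroup : (x ∷ u) ++ inv (x ∷ u) ≡ x ∷ ((u ++ inv u) ++ invL x ∷ [])
    regroup = trans (cong (λ z → x ∷ (u ++ z)) (inv-∷ x u))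
                    (cong (x ∷_) (sym (ListP.++-assoc u (inv u) (invL x ∷ []))))

  Pure : Word → Set
  Pure v = ∀ i → perm v i ≡ i

  pure? : ∀ v → Dec (Pure v)
  pure? v = FinP.all? λ i → perm v i FinP.≟ i

  -- A word is killed modulo M when it acts trivially on (ℤ/Mℤ)^n.
  record Killed (M : ℕ) (w : Word) : Set where
    constructor killed
    field
      fixes     : Pure w
      divisible : ∀ i → + M ∣ shift w i
  open Killed

  divides-0 : ∀ M → + M ∣ 0ℤ
  divides-0 M = ∣ᵤ⇒∣ (M ℕD.∣0)

  trivial⇒killed : ∀ {M w} → Trivial w → Killed M w
  trivial⇒killed {M} t = killed (perm≡ t) (λ i → subst (+ M ∣_) (sym (shift≡ t i)) (divides-0 M))

  killed-≈ : ∀ {M w w'} → w ≈ w' → Killed M w → Killed M w'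
  killed-≈ {M} e k = killed (λ i → trans (sym (perm≡ e i)) (fixes k i))
                            (λ i → subst (+ M ∣_) (shift≡ e i) (divisible k i))

  killed-++ : ∀ {M u v} → Killed M u → Killed M v → Killed M (u ++ v)
  killed-++ {M} {u} {v} ku kv = killed
    (λ i → trans (perm-++ u v i) (trans (cong (perm v) (fixes ku i)) (fixes kv i)))
    (λ i → subst (+ M ∣_) (sym (total i)) (∣m∣n⇒∣m+n (divisible ku i) (divisible kv i)))
    where
    total : ∀ i → shift (u ++ v) i ≡ shift u i + shift v i
    total i = trans (shift-++ u v i) (cong (λ j → shift u i + shift v j) (fixes ku i))

  killed-inv : ∀ {M r} → Killed M r → Killed M (inv r)
  killed-inv {M} {r} kr = killed fixes-inv
    (λ i → ∣m+n∣m⇒∣n (subst (+ M ∣_) (sym (cancels i)) (divides-0 M)) (divisible kr i))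
    where
    open ≡-Reasoning
    fixes-inv : Pure (inv r)
    fixes-inv i = begin
      perm (inv r) i           ≡⟨ cong (perm (inv r)) (sym (fixes kr i)) ⟩
      perm (inv r) (perm r i)  ≡⟨ sym (perm-++ r (inv r) i) ⟩
      perm (r ++ inv r) i      ≡⟨ perm≡ (inv-cancel r) i ⟩
      i                        ∎
    cancels : ∀ i → shift r i + shift (inv r) i ≡ 0ℤ
    cancels i = begin
      shift r i + shift (inv r) i           ≡⟨ cong (λ j → shift r i + shift (inv r) j) (sym (fixes kr i)) ⟩
      shift r i + shift (inv r) (perm r i)  ≡⟨ sym (shift-++ r (inv r) i) ⟩
      shift (r ++ inv r) i                  ≡⟨ shift≡ (inv-cancel r) i ⟩
      0ℤ                                    ∎

  killed-conj : ∀ {M r} u → Killed M r → Killed M (u ++ r ++ inv u)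
  killed-conj {M} {r} u kr = killed fixes-conj
    (λ i → subst (+ M ∣_) (sym (total i)) (divisible kr (perm u i)))
    where
    open ≡-Reasoning
    fixes-conj : Pure (u ++ r ++ inv u)
    fixes-conj i = begin
      perm (u ++ r ++ inv u) i          ≡⟨ perm-++ u (r ++ inv u) i ⟩
      perm (r ++ inv u) (perm u i)      ≡⟨ perm-++ r (inv u) (perm u i) ⟩
      perm (inv u) (perm r (perm u i))  ≡⟨ cong (perm (inv u)) (fixes kr (perm u i)) ⟩
      perm (inv u) (perm u i)           ≡⟨ sym (perm-++ u (inv u) i) ⟩
      perm (u ++ inv u) i               ≡⟨ perm≡ (inv-cancel u) i ⟩
      i                                 ∎
    total : ∀ i → shift (u ++ r ++ inv u) i ≡ shift r (perm u i)
    total i = begin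
      shift (u ++ r ++ inv u) i                          ≡⟨ shift-++ u (r ++ inv u) i ⟩
      shift u i + shift (r ++ inv u) j                   ≡⟨ cong (_+_ (shift u i)) (shift-++ r (inv u) j) ⟩
      shift u i + (shift r j + shift (inv u) (perm r j)) ≡⟨ cong (λ k → shift u i + (shift r j + shift (inv u) k)) (fixes kr j) ⟩
      shift u i + (shift r j + shift (inv u) j)          ≡⟨ x∙yz≈y∙xz (shift u i) (shift r j) _ ⟩
      shift r j + (shift u i + shift (inv u) j)          ≡⟨ cong (_+_ (shift r j)) (sym (shift-++ u (inv u) i)) ⟩
      shift r j + shift (u ++ inv u) i                   ≡⟨ cong (_+_ (shift r j)) (shift≡ (inv-cancel u) i) ⟩
      shift r j + 0ℤ                                     ≡⟨ ℤP.+-identityʳ _ ⟩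
      shift r j                                          ∎
      where j = perm u i

  NC⇒killed : ∀ {M R} → (∀ {r} → r ∈ R → Killed M r) → ∀ {w} → NC R w → Killed M w
  NC⇒killed {M} hR nc-one = killed (λ i → refl) (λ i → divides-0 M)
  NC⇒killed hR (nc-conj {r} {w} u r∈R nw) =
    subst (Killed _) (conj-assoc u r (inv u) w)
      (killed-++ (killed-conj u (hR r∈R)) (NC⇒killed hR nw))
  NC⇒killed hR (nc-conjInv {r} {w} u r∈R nw) =
    subst (Killed _) (conj-assoc u (inv r) (inv u) w)
      (killed-++ (killed-conj u (killed-inv (hR r∈R))) (NC⇒killed hR nw))
  NC⇒killed hR (nc-free e nw) = killed-≈ (free-invariant e) (NC⇒killed hR nw)

  power-pure : ∀ {v} → Pure v → ∀ j → Pure (v ^w j)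
  power-pure pv zero    i = refl
  power-pure {v} pv (suc j) i =
    trans (perm-++ v (v ^w j) i) (trans (cong (perm (v ^w j)) (pv i)) (power-pure pv j i))

  power-shift : ∀ {v} → Pure v → ∀ j i → shift (v ^w j) i ≡ + j * shift v i
  power-shift pv zero    i = refl
  power-shift {v} pv (suc j) i =
    trans (shift-++ v (v ^w j) i)
      (trans (cong (λ k → shift v i + shift (v ^w j) k) (pv i))
        (trans (cong (_+_ (shift v i)) (power-shift pv j i)) (sym (ℤP.suc-* (+ j) (shift v i)))))

  power-killed : ∀ {v} → Pure v → ∀ M → Killed M (v ^w M)
  power-killed {v} pv M = killed (power-pure pv M)
    (λ i → subst (+ M ∣_) (sym (power-shift pv M i)) (∣m⇒∣m*n (shift v i) ∣-refl))

  NoEarlyReturn : Word → (o : ℕ) → Fin degree → Set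
  NoEarlyReturn w o i = ∀ (r : Fin o) → perm (w ^w toℕ r) i ≡ i → toℕ r ≡ 0

  noEarlyReturn? : ∀ w o i → Dec (NoEarlyReturn w o i)
  noEarlyReturn? w o i = FinP.all? λ r → (perm (w ^w toℕ r) i FinP.≟ i) →-dec (toℕ r ℕ.≟ 0)

bc bac : Word
bc  = b ++ c
bac = b ++ a ++ c

shortRelators : List Word
shortRelators = (a ^w 2) ∷ (b ^w 2) ∷ (c ^w 2) ∷ ((a ++ b) ^w 3) ∷ ((a ++ c) ^w 2) ∷ []

record Witness (o : ℕ) : Set where
  field
    rep : MonomialRep
  open MonomialRep rep using (degree)
  open Action rep
  field
    short-trivial    : All Trivial shortRelators
    bc-pure          : Pure (bc ^w o)
    bac-pure         : Pure (bac ^w o)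
    unit-point       : Fin degree
    unit-translation : ∣ shift (bc ^w o) unit-point ∣ ≡ 1
    orbit-point      : Fin degree
    orbit-length     : NoEarlyReturn bc o orbit-point

module _ {o : ℕ} .{{_ : NonZero o}} (W : Witness o) where
  open Witness W
  open Action rep

  relators-killed : ∀ M {r} → r ∈ relH (M ℕ.* o) → Killed M r
  relators-killed M r∈ with ∈-++⁻ shortRelators r∈
  ... | inj₁ short               = trivial⇒killed (All.lookup short-trivial short)
  ... | inj₂ (here refl)         = subst (Killed M) (sym (^w-* bc M o)) (power-killed bc-pure M)
  ... | inj₂ (there (here refl)) = subst (Killed M) (sym (^w-* bac M o)) (power-killed bac-pure M)

  period-divides : ∀ {M} k → Killed M (bc ^w k) → o ℕD.∣ k
  period-divides k hk with k divMod o
  ... | result q r k≡r+qo = ℕD.divides q (trans k≡r+qo (cong (ℕ._+ q ℕ.* o) r≡0))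
    where
    split : bc ^w k ≡ bc ^w toℕ r ++ (bc ^w o) ^w q
    split = trans (cong (bc ^w_) k≡r+qo)
      (trans (^w-+ bc (toℕ r) (q ℕ.* o)) (cong (bc ^w toℕ r ++_) (^w-* bc q o)))
    returns : perm (bc ^w toℕ r) orbit-point ≡ orbit-point
    returns = trans (sym (power-pure bc-pure q _))
      (trans (sym (perm-++ (bc ^w toℕ r) _ orbit-point))
        (trans (cong (λ w → perm w orbit-point) (sym split)) (Killed.fixes hk orbit-point)))
    r≡0 : toℕ r ≡ 0
    r≡0 = orbit-length r returns

  periods-divisible : ∀ {M} q → Killed M (bc ^w (q ℕ.* o)) → M ℕD.∣ q
  periods-divisible {M} q hk =
    subst (M ℕD.∣_) count (∣⇒∣ᵤ (subst (+ M ∣_) (power-shift bc-pure q unit-point) translated))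
    where
    translated : + M ∣ shift ((bc ^w o) ^w q) unit-point
    translated = subst (λ w → + M ∣ shift w unit-point) (^w-* bc q o) (Killed.divisible hk unit-point)
    count : ∣ + q * shift (bc ^w o) unit-point ∣ ≡ q
    count = trans (ℤP.abs-* (+ q) _) (trans (cong (q ℕ.*_) unit-translation) (ℕP.*-identityʳ q))

  killed-bcPower : ∀ {M} k → Killed M (bc ^w k) → M ℕ.* o ℕD.∣ k
  killed-bcPower k hk with period-divides k hk
  ... | ℕD.divides q refl = ℕD.*-monoˡ-∣ o (periods-divisible q hk)

  witness⇒uncollapsed : ∀ M → Uncollapsed (M ℕ.* o)
  witness⇒uncollapsed M k 1≤k k<Mo same =
    ℕP.<⇒≱ k<Mo (ℕD.∣⇒≤ {{ℕ.>-nonZero 1≤k}} (killed-bcPower k bcPower-killed))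
    where
    inRelators : NC (relH k) (bc ^w k)
    inRelators = subst (NC (relH k)) (ListP.++-identityʳ (bc ^w k))
      (nc-conj [] (there (there (there (there (there (here refl)))))) nc-one)
    bcPower∈NC : NC (relH (M ℕ.* o)) (bc ^w k)
    bcPower∈NC = Equivalence.from (same (bc ^w k)) inRelators
    bcPower-killed : Killed M (bc ^w k)
    bcPower-killed = NC⇒killed (relators-killed M) bcPower∈NC

uncollapsed-powers : ∀ p e .{{_ : NonZero (p ^ e)}} → Witness (p ^ e) →
                     (n : ℕ) → e ≤ n → Uncollapsed (p ^ n)
uncollapsed-powers p e W n e≤n = subst Uncollapsed exponent (witness⇒uncollapsed W (p ^ (n ∸ e)))
  where
  exponent : p ^ (n ∸ e) ℕ.* p ^ e ≡ p ^ n
  exponent = trans (sym (ℕP.^-distribˡ-+-* p (n ∸ e) e)) (cong (p ^_) (ℕP.m∸n+n≡m e≤n))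

-- Degree 12, orbit length 5.  The first table lists the permutations of
-- a, b and c; the second their translations, which vanish outside the
-- coordinates listed.
fiveRep : MonomialRep
fiveRep = fromTables 12
  ( (# 2 ∷ # 5 ∷ # 0 ∷ # 4 ∷ # 3 ∷ # 1 ∷ # 10 ∷ # 8 ∷ # 7 ∷ # 11 ∷ # 6 ∷ # 9 ∷ [])
  ∷ (# 1 ∷ # 0 ∷ # 3 ∷ # 2 ∷ # 5 ∷ # 4 ∷ # 7 ∷ # 6 ∷ # 11 ∷ # 10 ∷ # 9 ∷ # 8 ∷ [])
  ∷ (# 1 ∷ # 0 ∷ # 5 ∷ # 10 ∷ # 6 ∷ # 2 ∷ # 4 ∷ # 11 ∷ # 9 ∷ # 8 ∷ # 3 ∷ # 7 ∷ [])
  ∷ [])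
  ( replicate 12 0ℤ [ # 1 ]≔ -1ℤ [ # 3 ]≔ -1ℤ [ # 4 ]≔ 1ℤ [ # 5 ]≔ 1ℤ [ # 6 ]≔ 1ℤ [ # 10 ]≔ -1ℤ
  ∷ replicate 12 0ℤ [ # 6 ]≔ 1ℤ [ # 7 ]≔ -1ℤ
  ∷ replicate 12 0ℤ [ # 0 ]≔ 1ℤ [ # 1 ]≔ -1ℤ
  ∷ [])

threeRep : MonomialRep
threeRep = fromTables 20
  ( (# 2 ∷ # 12 ∷ # 0 ∷ # 4 ∷ # 3 ∷ # 19 ∷ # 13 ∷ # 11 ∷ # 9 ∷ # 8 ∷ # 14 ∷ # 7 ∷ # 1 ∷ # 6 ∷ # 10 ∷ # 16 ∷ # 15 ∷ # 18 ∷ # 17 ∷ # 5 ∷ [])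
  ∷ (# 1 ∷ # 0 ∷ # 3 ∷ # 2 ∷ # 12 ∷ # 6 ∷ # 5 ∷ # 8 ∷ # 7 ∷ # 14 ∷ # 11 ∷ # 10 ∷ # 4 ∷ # 15 ∷ # 9 ∷ # 13 ∷ # 19 ∷ # 18 ∷ # 17 ∷ # 16 ∷ [])
  ∷ (# 1 ∷ # 0 ∷ # 12 ∷ # 19 ∷ # 5 ∷ # 4 ∷ # 7 ∷ # 6 ∷ # 14 ∷ # 10 ∷ # 9 ∷ # 13 ∷ # 2 ∷ # 11 ∷ # 8 ∷ # 18 ∷ # 17 ∷ # 16 ∷ # 15 ∷ # 3 ∷ [])
  ∷ [])
  ( replicate 20 0ℤ [ # 0 ]≔ -1ℤ [ # 2 ]≔ 1ℤ
  ∷ replicate 20 0ℤ [ # 4 ]≔ 1ℤ [ # 12 ]≔ -1ℤ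
  ∷ replicate 20 0ℤ [ # 0 ]≔ -1ℤ [ # 1 ]≔ 1ℤ
  ∷ [])

twoRep : MonomialRep
twoRep = fromTables 42
  ( (# 2 ∷ # 12 ∷ # 0 ∷ # 11 ∷ # 13 ∷ # 24 ∷ # 23 ∷ # 8 ∷ # 7 ∷ # 10 ∷ # 9 ∷ # 3 ∷ # 1 ∷ # 4 ∷ # 15 ∷ # 14 ∷ # 27 ∷ # 18 ∷ # 17 ∷ # 26 ∷ # 21 ∷ # 20 ∷ # 25 ∷ # 6 ∷ # 5 ∷ # 22 ∷ # 19 ∷ # 16 ∷ # 28 ∷ # 29 ∷ # 33 ∷ # 32 ∷ # 31 ∷ # 30 ∷ # 35 ∷ # 34 ∷ # 40 ∷ # 38 ∷ # 37 ∷ # 41 ∷ # 36 ∷ # 39 ∷ [])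
  ∷ (# 1 ∷ # 0 ∷ # 3 ∷ # 2 ∷ # 5 ∷ # 4 ∷ # 7 ∷ # 6 ∷ # 25 ∷ # 9 ∷ # 28 ∷ # 12 ∷ # 11 ∷ # 14 ∷ # 13 ∷ # 24 ∷ # 17 ∷ # 16 ∷ # 32 ∷ # 20 ∷ # 19 ∷ # 34 ∷ # 23 ∷ # 22 ∷ # 15 ∷ # 8 ∷ # 35 ∷ # 31 ∷ # 10 ∷ # 30 ∷ # 29 ∷ # 27 ∷ # 18 ∷ # 33 ∷ # 21 ∷ # 26 ∷ # 37 ∷ # 36 ∷ # 41 ∷ # 40 ∷ # 39 ∷ # 38 ∷ [])
  ∷ (# 1 ∷ # 0 ∷ # 12 ∷ # 4 ∷ # 3 ∷ # 6 ∷ # 5 ∷ # 10 ∷ # 9 ∷ # 8 ∷ # 7 ∷ # 13 ∷ # 2 ∷ # 11 ∷ # 27 ∷ # 16 ∷ # 15 ∷ # 26 ∷ # 19 ∷ # 18 ∷ # 25 ∷ # 22 ∷ # 21 ∷ # 24 ∷ # 23 ∷ # 20 ∷ # 17 ∷ # 14 ∷ # 29 ∷ # 28 ∷ # 31 ∷ # 30 ∷ # 33 ∷ # 32 ∷ # 40 ∷ # 36 ∷ # 35 ∷ # 41 ∷ # 39 ∷ # 38 ∷ # 34 ∷ # 37 ∷ [])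
  ∷ [])
  ( replicate 42 0ℤ
  ∷ replicate 42 0ℤ [ # 10 ]≔ -1ℤ [ # 28 ]≔ 1ℤ
  ∷ replicate 42 0ℤ
  ∷ [])

tableWitness : (o : ℕ) (ρ : MonomialRep) (p : Fin (MonomialRep.degree ρ)) →
               let open Action ρ in
               {True (All.all? trivial? shortRelators)} →
               {True (pure? (bc ^w o))} → {True (pure? (bac ^w o))} →
               ∣ shift (bc ^w o) p ∣ ≡ 1 → {True (noEarlyReturn? bc o p)} → Witness o
tableWitness o ρ p {short} {pure-bc} {pure-bac} unit {orbit} = record
  { rep              = ρ
  ; short-trivial    = toWitness short
  ; bc-pure          = toWitness pure-bc
  ; bac-pure         = toWitness pure-bac
  ; unit-point       = p
  ; unit-translation = unit
  ; orbit-point      = p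
  ; orbit-length     = toWitness orbit
  }

fiveWitness : Witness 5
fiveWitness = tableWitness 5 fiveRep (# 2) refl

threeWitness : Witness 9
threeWitness = tableWitness 9 threeRep (# 2) refl

twoWitness : Witness 8
twoWitness = tableWitness 8 twoRep (# 2) refl

theorem6p7 : ((n : ℕ) → 3 ≤ n → Uncollapsed (2 ^ n))
           × ((n : ℕ) → 2 ≤ n → Uncollapsed (3 ^ n))
           × ((n : ℕ) → 1 ≤ n → Uncollapsed (5 ^ n))
theorem6p7 = uncollapsed-powers 2 3 twoWitness
           , uncollapsed-powers 3 2 threeWitness
           , uncollapsed-powers 5 1 fiveWitness
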